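{- For every undirected graph $G$ and every positive integer $\ell$, the treewidth of both directed graphs $G_T(\ell)$ and $G^\star_T(\ell)$ is $O(\ell\cdot\mathrm{tw}(G))$.
   Context: For an undirected graph $G=(V,E)$ and positive integer $\ell$, the time-expanded graph $G_T(\ell)$ is the directed graph with vertex set $\{v_j : v\in V, j\in[0:\ell]\}$ and, for every $i\in[\ell]$, arcs $(v_{i-1},v_i)$ for every $v\in V$ and arcs $(u_{i-1},v_i)$ and $(v_{i-1},u_i)$ for every edge $\{u,v\}\in E$. The swap-free time-expanded graph $G^\star_T(\ell)$ is the directed graph with vertices $v_i$ for $v\in V$, $i\in[0:2\ell]$, and vertices $e_{2i-1}$ for $e\in E$, $i\in[\ell]$; its arcs are $(v_{i-1},v_i)$ for every $v\in V$ and $i\in[2\ell]$, and, for every edge $e=\{u,v\}\in E$ and $i\in[\ell]$, the four arcs $(u_{2i-2},e_{2i-1})$, $(v_{2i-2},e_{2i-1})$, $(e_{2i-1},u_{2i})$, $(e_{2i-1},v_{2i})$. The treewidth of a directed graph is the treewidth of its underlying undirected graph; $\mathrm{tw}(G)$ denotes the treewidth of $G$. -}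

module Defs where

open import Data.Nat using (ℕ; zero; suc; _+_; _*_; _≤_)
open import Data.Fin using (Fin; toℕ; inject₁; fromℕ)
open import Data.Product using (Σ; ∃; ∃-syntax; _×_; _,_; proj₁; proj₂)
open import Data.Sum using (_⊎_)
open import Data.List using (List; length)
open import Data.List.Membership.Propositional using (_∈_)
open import Relation.Binary.PropositionalEquality using (_≡_; _≢_)

record Graph : Set where
  field
    n        : ℕ
    m        : ℕ
    ends     : Fin m → Fin n × Fin n
    loopless : ∀ e → proj₁ (ends e) ≢ proj₂ (ends e)
    simple   : ∀ e f →
               (ends e ≡ ends f ⊎ (proj₁ (ends e) ≡ proj₂ (ends f) × proj₂ (ends e) ≡ proj₁ (ends f)))
               → e ≡ f

open Graph public

Adj : (G : Graph) → Fin (n G) → Fin (n G) → Set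
Adj G u v = ∃[ e ] (ends G e ≡ (u , v) ⊎ ends G e ≡ (v , u))

EndOf : (G : Graph) → Fin (m G) → Fin (n G) → Set
EndOf G e x = proj₁ (ends G e) ≡ x ⊎ proj₂ (ends G e) ≡ x

-- Treewidth only
-- depends on the underlying undirected graph; the tree-decomposition
-- conditions below are symmetric in the two ends of an arc.

record Digraph : Set₁ where
  field
    Vert : Set
    Arc  : Vert → Vert → Set

open Digraph public

undirected : Graph → Digraph
undirected G = record { Vert = Fin (n G) ; Arc = Adj G }

-- Trees on node set Fin (suc t), encoded by parent pointers: every
-- non-root node i : Fin t (i.e. inject₁ i) has a parent of strictly larger
-- index; the root is fromℕ t.  Every finite tree admits such a labelling.

record Tree : Set where
  field
    t      : ℕ
    parent : Fin t → Fin (suc t)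
    up     : ∀ i → toℕ i Data.Nat.< toℕ (parent i)

open Tree public

Node : Tree → Set
Node T = Fin (suc (t T))

TAdj : (T : Tree) → Node T → Node T → Set
TAdj T x y = ∃[ i ] ((inject₁ i ≡ x × parent T i ≡ y) ⊎ (inject₁ i ≡ y × parent T i ≡ x))

data WalkIn (T : Tree) (P : Node T → Set) : Node T → Node T → Set where
  here : ∀ {x} → P x → WalkIn T P x x
  step : ∀ {x y z} → P x → TAdj T x y → WalkIn T P y z → WalkIn T P x z

record TreeDecomposition (D : Digraph) : Set₁ where
  field
    tree      : Tree
    bag       : Node tree → List (Vert D)
    covers-v  : ∀ v → ∃[ x ] (v ∈ bag x)
    covers-e  : ∀ u v → Arc D u v → ∃[ x ] (u ∈ bag x × v ∈ bag x)
    connected : ∀ v x y → v ∈ bag x → v ∈ bag y →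
                WalkIn tree (λ z → v ∈ bag z) x y

open TreeDecomposition public

WidthAtMost : ∀ {D} → TreeDecomposition D → ℕ → Set
WidthAtMost TD k = ∀ x → length (bag TD x) ≤ suc k

TwAtMost : Digraph → ℕ → Set₁
TwAtMost D k = Σ (TreeDecomposition D) λ TD → WidthAtMost TD k

data TArc (G : Graph) (ℓ : ℕ) : Fin (n G) × Fin (suc ℓ) → Fin (n G) × Fin (suc ℓ) → Set where
  stay : ∀ {v j j'} → toℕ j' ≡ suc (toℕ j) → TArc G ℓ (v , j) (v , j')
  move : ∀ {u v j j'} → toℕ j' ≡ suc (toℕ j) → Adj G u v → TArc G ℓ (u , j) (v , j')

GT : Graph → ℕ → Digraph
GT G ℓ = record { Vert = Fin (n G) × Fin (suc ℓ) ; Arc = TArc G ℓ }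

-- Swap-free time-expanded graph G*_T(ℓ).
-- vtx v j   stands for v_j,          j ∈ [0:2ℓ]
-- evtx e i  stands for e_{2(i+1)-1}, i.e. index i+1 ∈ [ℓ]

data SVert (G : Graph) (ℓ : ℕ) : Set where
  vtx  : Fin (n G) → Fin (suc (2 * ℓ)) → SVert G ℓ
  evtx : Fin (m G) → Fin ℓ → SVert G ℓ

data SArc (G : Graph) (ℓ : ℕ) : SVert G ℓ → SVert G ℓ → Set where
  stay : ∀ {v j j'} → toℕ j' ≡ suc (toℕ j) → SArc G ℓ (vtx v j) (vtx v j')
  -- (u_{2i-2}, e_{2i-1}) for u an endpoint of e
  enter : ∀ {e x i j} → EndOf G e x → toℕ j ≡ 2 * toℕ i →
          SArc G ℓ (vtx x j) (evtx e i)
  -- (e_{2i-1}, u_{2i}) for u an endpoint of e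
  leave : ∀ {e x i j} → EndOf G e x → toℕ j ≡ 2 * toℕ i + 2 →
          SArc G ℓ (evtx e i) (vtx x j)

GTstar : Graph → ℕ → Digraph
GTstar G ℓ = record { Vert = SVert G ℓ ; Arc = SArc G ℓ }

-- An arc of G_T(ℓ) joins time copies of equal or adjacent vertices of G, so replacing every vertex
-- of every bag of a tree decomposition of G by its ℓ+1 time copies gives a tree decomposition of
-- G_T(ℓ) with bags of size (k+1)(ℓ+1).  In G*_T(ℓ) the vertex copies are handled in the same way
-- (now 2ℓ+1 of them), and every edge e = {u,v} gets a new leaf, attached to a bag containing u
-- and v, whose bag holds all copies of u, v and e; it has 5ℓ+2 elements.  Both bounds are at most
-- 7ℓ(k+1) once ℓ ≥ 1.
module Submission where

open import Defs
open import Data.Nat using (ℕ; suc; _*_; _≤_)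
open import Data.Product using (∃-syntax; _×_)

open import Data.Nat using (_+_; _<_; _⊔_; z≤n; s≤s)
open import Data.Nat.Properties
  using (≤-trans; m≤m+n; m≤n⇒m≤1+n; m≤n⇒m≤n+o; m≤m*n; m≤m⊔n; m≤n⊔m; ⊔-lub;
         *-comm; *-monoˡ-≤; *-monoʳ-≤; +-monoʳ-<; +-suc)
open import Data.Nat.Tactic.RingSolver using (solve-∀)
open import Data.Fin using (Fin; toℕ; inject₁; cast; splitAt; join)
open import Data.Fin.Properties
  using (toℕ-injective; toℕ-cast; toℕ-inject₁; toℕ-↑ˡ; toℕ-↑ʳ; toℕ<n;
         cast-involutive; splitAt-join; join-splitAt)
open import Data.Product using (_,_; proj₁; proj₂)
open import Data.Sum using (_⊎_; inj₁; inj₂; [_,_]′; map₂)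
open import Function using (id; _∘_)
open import Data.List using (List; []; _∷_; map; _++_; length; allFin; cartesianProductWith)
open import Data.List.Properties using (length-++; length-map; length-tabulate)
open import Data.List.Relation.Unary.Any using (here; there)
open import Data.List.Membership.Propositional using (_∈_)
open import Data.List.Membership.Propositional.Properties
  using (∈-map⁺; ∈-map⁻; ∈-++⁺ˡ; ∈-++⁺ʳ; ∈-++⁻; ∈-allFin;
         ∈-cartesianProductWith⁺; ∈-cartesianProductWith⁻)
open import Relation.Binary.PropositionalEquality
  using (_≡_; refl; sym; trans; cong; cong₂; subst; subst₂; module ≡-Reasoning)

module _ {T : Tree} where

  TAdj-sym : ∀ {x y} → TAdj T x y → TAdj T y x
  TAdj-sym (i , inj₁ p) = i , inj₂ p
  TAdj-sym (i , inj₂ p) = i , inj₁ p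

  module _ {P : Node T → Set} where

    WalkIn-head : ∀ {x y} → WalkIn T P x y → P x
    WalkIn-head (here p)     = p
    WalkIn-head (step p _ _) = p

    infixr 5 _◅◅_
    _◅◅_ : ∀ {x y z} → WalkIn T P x y → WalkIn T P y z → WalkIn T P x z
    here _     ◅◅ w′ = w′
    step p a w ◅◅ w′ = step p a (w ◅◅ w′)

    WalkIn-reverse : ∀ {x y} → WalkIn T P x y → WalkIn T P y x
    WalkIn-reverse (here p)     = here p
    WalkIn-reverse (step p a w) = WalkIn-reverse w ◅◅ step (WalkIn-head w) (TAdj-sym a) (here p)

WalkIn-map : ∀ {T T′ : Tree} {P : Node T → Set} {Q : Node T′ → Set} (f : Node T → Node T′) →
             (∀ {x y} → TAdj T x y → TAdj T′ (f x) (f y)) → (∀ {z} → P z → Q (f z)) →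
             ∀ {x y} → WalkIn T P x y → WalkIn T′ Q (f x) (f y)
WalkIn-map f f-adj f-P (here p)     = here (f-P p)
WalkIn-map f f-adj f-P (step p a w) = step (f-P p) (f-adj a) (WalkIn-map f f-adj f-P w)

toℕ-join : ∀ m n (s : Fin m ⊎ Fin n) → toℕ (join m n s) ≡ [ toℕ , (m +_) ∘ toℕ ]′ s
toℕ-join m n (inj₁ i) = toℕ-↑ˡ i n
toℕ-join m n (inj₂ j) = toℕ-↑ʳ m j

-- The leaves take the first m positions of the parent-pointer labelling, so that each of them
-- sits below the (shifted) node it is attached to.
module AttachLeaves (T : Tree) {m : ℕ} (anchor : Fin m → Node T) where

  private
    eq : m + suc (t T) ≡ suc (m + t T)
    eq = +-suc m (t T)
    eq⁻¹ : suc (m + t T) ≡ m + suc (t T)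
    eq⁻¹ = sym eq

  node : Fin m ⊎ Node T → Fin (suc (m + t T))
  node = cast eq ∘ join m (suc (t T))

  classify : Fin (suc (m + t T)) → Fin m ⊎ Node T
  classify = splitAt m ∘ cast eq⁻¹

  classify-node : ∀ s → classify (node s) ≡ s
  classify-node s =
    trans (cong (splitAt m) (cast-involutive eq⁻¹ eq (join m _ s))) (splitAt-join m _ s)

  node-classify : ∀ z → node (classify z) ≡ z
  node-classify z =
    trans (cong (cast eq) (join-splitAt m _ (cast eq⁻¹ z))) (cast-involutive eq eq⁻¹ z)

  toℕ-node : ∀ s → toℕ (node s) ≡ [ toℕ , (m +_) ∘ toℕ ]′ s
  toℕ-node s = trans (toℕ-cast eq (join m _ s)) (toℕ-join m _ s)

  leaf : Fin m → Fin (suc (m + t T))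
  leaf = node ∘ inj₁

  old : Node T → Fin (suc (m + t T))
  old = node ∘ inj₂

  parentOf : Fin m ⊎ Fin (t T) → Node T
  parentOf = [ anchor , parent T ]′

  up-join : ∀ s → toℕ (join m (t T) s) < toℕ (old (parentOf s))
  up-join (inj₁ e) rewrite toℕ-↑ˡ e (t T) | toℕ-node (inj₂ (anchor e)) =
    m≤n⇒m≤n+o (toℕ (anchor e)) (toℕ<n e)
  up-join (inj₂ i) rewrite toℕ-↑ʳ m i | toℕ-node (inj₂ (parent T i)) =
    +-monoʳ-< m (up T i)

  tree′ : Tree
  tree′ = record
    { t      = m + t T
    ; parent = old ∘ parentOf ∘ splitAt m
    ; up     = λ i → subst (λ j → toℕ j < toℕ (old (parentOf (splitAt m i))))
                           (join-splitAt m (t T) i) (up-join (splitAt m i))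
    }

  join-parent-adj : ∀ s → TAdj tree′ (node (map₂ inject₁ s)) (old (parentOf s))
  join-parent-adj s =
    join m (t T) s , inj₁ (inject₁-join , cong (old ∘ parentOf) (splitAt-join m (t T) s))
    where
    inject₁-join : inject₁ (join m (t T) s) ≡ node (map₂ inject₁ s)
    inject₁-join = toℕ-injective (begin
      toℕ (inject₁ (join m (t T) s))            ≡⟨ toℕ-inject₁ (join m (t T) s) ⟩
      toℕ (join m (t T) s)                      ≡⟨ toℕ-join m (t T) s ⟩
      [ toℕ , (m +_) ∘ toℕ ]′ s                 ≡⟨ toℕ-inject₁-right s ⟩
      [ toℕ , (m +_) ∘ toℕ ]′ (map₂ inject₁ s)  ≡⟨ toℕ-node (map₂ inject₁ s) ⟨
      toℕ (node (map₂ inject₁ s))               ∎)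
      where
      open ≡-Reasoning
      toℕ-inject₁-right : ∀ s → [ toℕ , (m +_) ∘ toℕ ]′ s ≡ [ toℕ , (m +_) ∘ toℕ ]′ (map₂ inject₁ s)
      toℕ-inject₁-right (inj₁ e) = refl
      toℕ-inject₁-right (inj₂ i) = cong (m +_) (sym (toℕ-inject₁ i))

  leaf-adj : ∀ e → TAdj tree′ (leaf e) (old (anchor e))
  leaf-adj e = join-parent-adj (inj₁ e)

  old-adj : ∀ {x y} → TAdj T x y → TAdj tree′ (old x) (old y)
  old-adj (i , inj₁ (refl , refl)) = join-parent-adj (inj₂ i)
  old-adj (i , inj₂ (refl , refl)) = TAdj-sym {tree′} (join-parent-adj (inj₂ i))

length-cartesianProductWith : ∀ {a b c} {A : Set a} {B : Set b} {C : Set c} (f : A → B → C) xs ys →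
                              length (cartesianProductWith f xs ys) ≡ length xs * length ys
length-cartesianProductWith f []       ys = refl
length-cartesianProductWith f (x ∷ xs) ys = begin
  length (map (f x) ys ++ cartesianProductWith f xs ys)
    ≡⟨ length-++ (map (f x) ys) ⟩
  length (map (f x) ys) + length (cartesianProductWith f xs ys)
    ≡⟨ cong₂ _+_ (length-map (f x) ys) (length-cartesianProductWith f xs ys) ⟩
  length ys + length xs * length ys
    ∎
  where open ≡-Reasoning

length-allFin : ∀ n → length (allFin n) ≡ n
length-allFin n = length-tabulate id

module _ {V W : Set} {J : ℕ} (f : V → Fin J → W) where

  copies : List V → List W
  copies vs = cartesianProductWith f vs (allFin J)

  ∈-copies⁺ : ∀ {v vs} j → v ∈ vs → f v j ∈ copies vs
  ∈-copies⁺ j v∈vs = ∈-cartesianProductWith⁺ f v∈vs (∈-allFin j)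

  ∈-copies⁻ : ∀ vs {w} → w ∈ copies vs → ∃[ v ] ∃[ j ] (v ∈ vs × w ≡ f v j)
  ∈-copies⁻ vs w∈ with v , j , v∈vs , _ , w≡ ← ∈-cartesianProductWith⁻ f vs (allFin J) w∈ =
    v , j , v∈vs , w≡

  length-copies : ∀ vs → length (copies vs) ≡ length vs * J
  length-copies vs =
    trans (length-cartesianProductWith f vs (allFin J)) (cong (length vs *_) (length-allFin J))

BagsAtMost : ∀ {D} → TreeDecomposition D → ℕ → Set
BagsAtMost TD b = ∀ x → length (bag TD x) ≤ b

module BlowUp {D : Digraph} (TD : TreeDecomposition D) (J : ℕ)
              {A : Vert D × Fin J → Vert D × Fin J → Set}
              (projects : ∀ {u i v j} → A (u , i) (v , j) → u ≡ v ⊎ Arc D u v) where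

  Blown : Digraph
  Blown = record { Vert = Vert D × Fin J ; Arc = A }

  private
    pair : Vert D → Fin J → Vert D × Fin J
    pair = _,_

    project-∈ : ∀ {v j x} → (v , j) ∈ copies pair (bag TD x) → v ∈ bag TD x
    project-∈ {x = x} p with _ , _ , v∈ , refl ← ∈-copies⁻ pair (bag TD x) p = v∈

    covers-e′ : ∀ p q → A p q → ∃[ x ] (p ∈ copies pair (bag TD x) × q ∈ copies pair (bag TD x))
    covers-e′ (u , i) (v , j) a with projects a
    ... | inj₁ refl with x , u∈ ← covers-v TD u = x , ∈-copies⁺ pair i u∈ , ∈-copies⁺ pair j u∈
    ... | inj₂ uv   with x , u∈ , v∈ ← covers-e TD u v uv =
      x , ∈-copies⁺ pair i u∈ , ∈-copies⁺ pair j v∈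

  decomposition : TreeDecomposition Blown
  decomposition = record
    { tree      = tree TD
    ; bag       = copies pair ∘ bag TD
    ; covers-v  = λ (v , j) → let x , v∈ = covers-v TD v in x , ∈-copies⁺ pair j v∈
    ; covers-e  = covers-e′
    ; connected = λ (v , j) x y p q →
        WalkIn-map id id (∈-copies⁺ pair j) (connected TD v x y (project-∈ p) (project-∈ q))
    }

  bags : ∀ {b} → BagsAtMost TD b → BagsAtMost decomposition (b * J)
  bags {b} small x = subst (_≤ b * J) (sym (length-copies pair (bag TD x))) (*-monoˡ-≤ J (small x))

module SwapFree (G : Graph) (ℓ : ℕ) (TD : TreeDecomposition (undirected G)) where

  J : ℕ
  J = suc (2 * ℓ)

  endpoints : Fin (m G) → List (Fin (n G))
  endpoints e = proj₁ (ends G e) ∷ proj₂ (ends G e) ∷ []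

  ∈-endpoints⁺ : ∀ {e v} → EndOf G e v → v ∈ endpoints e
  ∈-endpoints⁺ (inj₁ refl) = here refl
  ∈-endpoints⁺ (inj₂ refl) = there (here refl)

  ∈-endpoints⁻ : ∀ {e v} → v ∈ endpoints e → EndOf G e v
  ∈-endpoints⁻ (here refl)         = inj₁ refl
  ∈-endpoints⁻ (there (here refl)) = inj₂ refl

  anchor : Fin (m G) → Node (tree TD)
  anchor e = proj₁ (covers-e TD _ _ (e , inj₁ refl))

  endpoint-∈-anchor : ∀ {e v} → EndOf G e v → v ∈ bag TD (anchor e)
  endpoint-∈-anchor {e} (inj₁ refl) = proj₁ (proj₂ (covers-e TD _ _ (e , inj₁ refl)))
  endpoint-∈-anchor {e} (inj₂ refl) = proj₂ (proj₂ (covers-e TD _ _ (e , inj₁ refl)))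

  open AttachLeaves (tree TD) anchor

  host : Fin (m G) ⊎ Node (tree TD) → Node (tree TD)
  host = [ anchor , id ]′

  vertex : Fin (n G) → Fin J → SVert G ℓ
  vertex = vtx

  vertexCopies : List (Fin (n G)) → List (SVert G ℓ)
  vertexCopies = copies vertex

  edgeCopies : Fin (m G) → List (SVert G ℓ)
  edgeCopies e = map (evtx e) (allFin ℓ)

  bagOf : Fin (m G) ⊎ Node (tree TD) → List (SVert G ℓ)
  bagOf (inj₁ e) = vertexCopies (endpoints e) ++ edgeCopies e
  bagOf (inj₂ x) = vertexCopies (bag TD x)

  bag′ : Node tree′ → List (SVert G ℓ)
  bag′ = bagOf ∘ classify

  ∈-bag′⁺ : ∀ {w} s → w ∈ bagOf s → w ∈ bag′ (node s)
  ∈-bag′⁺ {w} s = subst (λ s → w ∈ bagOf s) (sym (classify-node s))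

  vtx-∈-host : ∀ {v j} s → vtx v j ∈ bagOf s → v ∈ bag TD (host s)
  vtx-∈-host (inj₂ x) p with _ , _ , v∈ , refl ← ∈-copies⁻ vertex (bag TD x) p = v∈
  vtx-∈-host (inj₁ e) p with ∈-++⁻ (vertexCopies (endpoints e)) p
  ... | inj₁ q with _ , _ , v∈ , refl ← ∈-copies⁻ vertex (endpoints e) q =
    endpoint-∈-anchor (∈-endpoints⁻ v∈)
  ... | inj₂ q with _ , _ , () ← ∈-map⁻ (evtx e) q

  evtx-∈⇒leaf : ∀ {e i} s → evtx e i ∈ bagOf s → s ≡ inj₁ e
  evtx-∈⇒leaf (inj₂ x) p with _ , _ , _ , () ← ∈-copies⁻ vertex (bag TD x) p
  evtx-∈⇒leaf (inj₁ e) p with ∈-++⁻ (vertexCopies (endpoints e)) p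
  ... | inj₁ q with _ , _ , _ , () ← ∈-copies⁻ vertex (endpoints e) q
  ... | inj₂ q with _ , _ , refl ← ∈-map⁻ (evtx e) q = refl

  Holding : SVert G ℓ → Node tree′ → Set
  Holding w z = w ∈ bag′ z

  walk-to-host : ∀ {v j} s → vtx v j ∈ bagOf s →
                 WalkIn tree′ (Holding (vtx v j)) (node s) (old (host s))
  walk-to-host (inj₂ x) p = here (∈-bag′⁺ (inj₂ x) p)
  walk-to-host {j = j} (inj₁ e) p =
    step (∈-bag′⁺ (inj₁ e) p) (leaf-adj e)
         (here (∈-bag′⁺ (inj₂ (anchor e)) (∈-copies⁺ vertex j (vtx-∈-host (inj₁ e) p))))

  connected-node : ∀ w s₁ s₂ → w ∈ bagOf s₁ → w ∈ bagOf s₂ →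
                   WalkIn tree′ (Holding w) (node s₁) (node s₂)
  connected-node (vtx v j) s₁ s₂ p q =
    walk-to-host s₁ p ◅◅
    WalkIn-map old old-adj (λ {x} → ∈-bag′⁺ (inj₂ x) ∘ ∈-copies⁺ vertex j)
      (connected TD v _ _ (vtx-∈-host s₁ p) (vtx-∈-host s₂ q)) ◅◅
    WalkIn-reverse (walk-to-host s₂ q)
  connected-node (evtx e i) s₁ s₂ p q with refl ← evtx-∈⇒leaf s₁ p | refl ← evtx-∈⇒leaf s₂ q =
    here (∈-bag′⁺ s₁ p)

  decomposition : TreeDecomposition (GTstar G ℓ)
  decomposition = record
    { tree      = tree′
    ; bag       = bag′
    ; covers-v  = covers-v′
    ; covers-e  = covers-e′
    ; connected = λ w z₁ z₂ p q →
        subst₂ (WalkIn tree′ (Holding w)) (node-classify z₁) (node-classify z₂)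
          (connected-node w (classify z₁) (classify z₂) p q)
    }
    where
    vtx-∈-bag′-leaf : ∀ {e v} j → EndOf G e v → vtx v j ∈ bag′ (leaf e)
    vtx-∈-bag′-leaf {e} j v∈e = ∈-bag′⁺ (inj₁ e) (∈-++⁺ˡ (∈-copies⁺ vertex j (∈-endpoints⁺ v∈e)))

    evtx-∈-bag′-leaf : ∀ {e} i → evtx e i ∈ bag′ (leaf e)
    evtx-∈-bag′-leaf {e} i = ∈-bag′⁺ (inj₁ e) (∈-++⁺ʳ _ (∈-map⁺ (evtx e) (∈-allFin i)))

    covers-v′ : ∀ w → ∃[ z ] (w ∈ bag′ z)
    covers-v′ (vtx v j)  =
      let x , v∈ = covers-v TD v in old x , ∈-bag′⁺ (inj₂ x) (∈-copies⁺ vertex j v∈)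
    covers-v′ (evtx e i) = leaf e , evtx-∈-bag′-leaf i

    covers-e′ : ∀ w w′ → SArc G ℓ w w′ → ∃[ z ] (w ∈ bag′ z × w′ ∈ bag′ z)
    covers-e′ (vtx v j) (vtx .v j′) (stay _) =
      let x , v∈ = covers-v TD v in
      old x , ∈-bag′⁺ (inj₂ x) (∈-copies⁺ vertex j v∈) , ∈-bag′⁺ (inj₂ x) (∈-copies⁺ vertex j′ v∈)
    covers-e′ (vtx v j) (evtx e i) (enter v∈e _)  = leaf e , vtx-∈-bag′-leaf j v∈e , evtx-∈-bag′-leaf i
    covers-e′ (evtx e i) (vtx v j) (leave v∈e _)  = leaf e , evtx-∈-bag′-leaf i , vtx-∈-bag′-leaf j v∈e

  length-leafBag : ∀ e → length (bagOf (inj₁ e)) ≡ 2 * J + ℓ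
  length-leafBag e = begin
    length (vertexCopies (endpoints e) ++ edgeCopies e)
      ≡⟨ length-++ (vertexCopies (endpoints e)) ⟩
    length (vertexCopies (endpoints e)) + length (edgeCopies e)
      ≡⟨ cong₂ _+_ (length-copies vertex (endpoints e))
                   (trans (length-map (evtx e) (allFin ℓ)) (length-allFin ℓ)) ⟩
    2 * J + ℓ
      ∎
    where open ≡-Reasoning

  bags : ∀ {b} → BagsAtMost TD b → BagsAtMost decomposition (b * J ⊔ (2 * J + ℓ))
  bags {b} small z with classify z
  ... | inj₁ e = subst (_≤ b * J ⊔ (2 * J + ℓ)) (sym (length-leafBag e)) (m≤n⊔m (b * J) _)
  ... | inj₂ x = subst (_≤ b * J ⊔ (2 * J + ℓ)) (sym (length-copies vertex (bag TD x)))
                   (≤-trans (*-monoˡ-≤ J (small x)) (m≤m⊔n _ _))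

widthAtMost : ∀ {D} (TD : TreeDecomposition D) {b k} → BagsAtMost TD b → b ≤ k → WidthAtMost TD k
widthAtMost _ small b≤k x = m≤n⇒m≤1+n (≤-trans (small x) b≤k)

m+n≡o⇒m≤o : ∀ m n {o} → m + n ≡ o → m ≤ o
m+n≡o⇒m≤o m n refl = m≤m+n m n

copies≤ : ∀ k {J} ℓ → J ≤ 7 * ℓ → suc k * J ≤ 7 * ℓ * suc k
copies≤ k {J} ℓ J≤ = subst (suc k * J ≤_) (*-comm (suc k) (7 * ℓ)) (*-monoʳ-≤ (suc k) J≤)

1+ℓ≤7ℓ : ∀ l → suc (suc l) ≤ 7 * suc l
1+ℓ≤7ℓ l = m+n≡o⇒m≤o (suc (suc l)) (6 * l + 5) (identity l)
  where
  identity : ∀ l → suc (suc l) + (6 * l + 5) ≡ 7 * suc l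
  identity = solve-∀

1+2ℓ≤7ℓ : ∀ l → suc (2 * suc l) ≤ 7 * suc l
1+2ℓ≤7ℓ l = m+n≡o⇒m≤o (suc (2 * suc l)) (5 * l + 4) (identity l)
  where
  identity : ∀ l → suc (2 * suc l) + (5 * l + 4) ≡ 7 * suc l
  identity = solve-∀

2+5ℓ≤7ℓ : ∀ l → 2 * suc (2 * suc l) + suc l ≤ 7 * suc l
2+5ℓ≤7ℓ l = m+n≡o⇒m≤o (2 * suc (2 * suc l) + suc l) (2 * l) (identity l)
  where
  identity : ∀ l → 2 * suc (2 * suc l) + suc l + 2 * l ≡ 7 * suc l
  identity = solve-∀

GT-projects : ∀ {G ℓ u i v j} → TArc G ℓ (u , i) (v , j) → u ≡ v ⊎ Adj G u v
GT-projects (stay _)   = inj₁ refl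
GT-projects (move _ a) = inj₂ a

lemma1 : ∃[ c ] (∀ (G : Graph) (ℓ : ℕ) → 1 ≤ ℓ → (k : ℕ) → TwAtMost (undirected G) k →
           TwAtMost (GT G ℓ) (c * ℓ * suc k) × TwAtMost (GTstar G ℓ) (c * ℓ * suc k))
lemma1 = 7 , λ where
  G (suc l) (s≤s z≤n) k (TD , width) →
    let module GT = BlowUp TD (suc (suc l)) {TArc G (suc l)} GT-projects
        module G* = SwapFree G (suc l) TD
    in ( GT.decomposition
       , widthAtMost GT.decomposition (GT.bags width) (copies≤ k (suc l) (1+ℓ≤7ℓ l)) )
     , ( G*.decomposition
       , widthAtMost G*.decomposition (G*.bags width)
           (⊔-lub (copies≤ k (suc l) (1+2ℓ≤7ℓ l))
                  (≤-trans (2+5ℓ≤7ℓ l) (m≤m*n (7 * suc l) (suc k)))) )
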